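{- Let $0<\delta<0.5$ and let $G=(V,E)$ be a graph on $n$ vertices with minimum degree at least $\delta n$. Then there exists $S\subseteq V$ such that (1) $|S|\leq 2/\delta$, and (2) for every $v\in V\setminus S$ there exists $s\in S$ with $|N(v)\cap N(s)|\geq \delta^2 n/4$.
   Context: $N(v)$ denotes the set of neighbors of $v$ in $G$.
   Formalization: The parameter δ takes only rational values in the interval $0<\delta<0.5$. -}

module Defs where

open import Data.Nat using (ℕ)
open import Data.Fin using (Fin)
open import Data.Fin.Subset using (Subset; _∈_; _∉_)
open import Relation.Nullary using (¬_)

record Graph (n : ℕ) : Set where
  field
    N        : Fin n → Subset n
    symmetric : ∀ u v → u ∈ N v → v ∈ N u
    loopless  : ∀ v → v ∉ N v

-- Choose greedily a maximal list of vertices whose neighbourhoods pairwise share fewer than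
-- δ²n/4 vertices; maximality is exactly property (2). For (1), Bonferroni's inequality for the
-- neighbourhoods of t such vertices gives n ≥ tδn − C(t,2)δ²n/4. Growing the list one vertex at a
-- time keeps tδ ≤ 2: if (t−1)δ ≤ 2, then 1 ≥ tδ(1 − (t−1)δ/8) ≥ 3tδ/4, so tδ ≤ 4/3.
module Submission where

open import Relation.Binary.Definitions using (Decidable)
open import Data.Nat using (ℕ)
open import Defs using (Graph)

module Counting where
  open import Data.Nat
  open import Data.Nat.Properties
  open import Data.Nat.ListAction using (sum)
  open import Data.Nat.Combinatorics using (_C_; nC1≡n; nCk+nC[k+1]≡[n+1]C[k+1])
  open import Data.List using (List; []; _∷_; map; length)
  open import Data.List.Relation.Unary.All using (All; []; _∷_)
  open import Data.List.Relation.Unary.AllPairs using (AllPairs; []; _∷_)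
  open import Data.Vec using (_∷_; [])
  open import Data.Fin using (Fin)
  open import Data.Fin.Subset using (Subset; _∈_; _∪_; _∩_; ∣_∣; ⋃; ⁅_⁆; inside; outside)
  open import Data.Fin.Subset.Properties using (∣⁅x⁆∣≡1; ∣⊥∣≡0; ∩-zeroʳ; ∩-distribˡ-∪; x∈⁅x⁆; x∈p∪q⁺)
  open import Relation.Binary.PropositionalEquality
  open import Data.Sum using (inj₁; inj₂)
  open import Data.List.Relation.Unary.Any using (here; there)
  import Data.List.Membership.Propositional as List
  open ≤-Reasoning

  ∣p∪q∣+∣p∩q∣≡∣p∣+∣q∣ : ∀ {n} (p q : Subset n) → ∣ p ∪ q ∣ + ∣ p ∩ q ∣ ≡ ∣ p ∣ + ∣ q ∣
  ∣p∪q∣+∣p∩q∣≡∣p∣+∣q∣ []            []            = refl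
  ∣p∪q∣+∣p∩q∣≡∣p∣+∣q∣ (outside ∷ p) (outside ∷ q) = ∣p∪q∣+∣p∩q∣≡∣p∣+∣q∣ p q
  ∣p∪q∣+∣p∩q∣≡∣p∣+∣q∣ (inside ∷ p)  (outside ∷ q) = cong suc (∣p∪q∣+∣p∩q∣≡∣p∣+∣q∣ p q)
  ∣p∪q∣+∣p∩q∣≡∣p∣+∣q∣ (outside ∷ p) (inside ∷ q)  =
    trans (cong suc (∣p∪q∣+∣p∩q∣≡∣p∣+∣q∣ p q)) (sym (+-suc ∣ p ∣ ∣ q ∣))
  ∣p∪q∣+∣p∩q∣≡∣p∣+∣q∣ (inside ∷ p)  (inside ∷ q)  = cong suc (begin-equality
    ∣ p ∪ q ∣ + suc ∣ p ∩ q ∣ ≡⟨ +-suc ∣ p ∪ q ∣ ∣ p ∩ q ∣ ⟩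
    suc (∣ p ∪ q ∣ + ∣ p ∩ q ∣) ≡⟨ cong suc (∣p∪q∣+∣p∩q∣≡∣p∣+∣q∣ p q) ⟩
    suc (∣ p ∣ + ∣ q ∣) ≡⟨ +-suc ∣ p ∣ ∣ q ∣ ⟨
    ∣ p ∣ + suc ∣ q ∣ ∎)

  ∣p∪q∣≤∣p∣+∣q∣ : ∀ {n} (p q : Subset n) → ∣ p ∪ q ∣ ≤ ∣ p ∣ + ∣ q ∣
  ∣p∪q∣≤∣p∣+∣q∣ p q = ≤-trans (m≤m+n ∣ p ∪ q ∣ ∣ p ∩ q ∣) (≤-reflexive (∣p∪q∣+∣p∩q∣≡∣p∣+∣q∣ p q))

  module _ {A : Set} where

    pairSum : (A → A → ℕ) → List A → ℕ
    pairSum w []       = 0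
    pairSum w (x ∷ xs) = sum (map (w x) xs) + pairSum w xs

    length*≤sum : ∀ {m} k (f : A → ℕ) → (∀ x → m ≤ k * f x) →
                  (xs : List A) → length xs * m ≤ k * sum (map f xs)
    length*≤sum k f lower []       = ≤-reflexive (sym (*-zeroʳ k))
    length*≤sum k f lower (x ∷ xs) = begin
      _ + length xs * _             ≤⟨ +-mono-≤ (lower x) (length*≤sum k f lower xs) ⟩
      k * f x + k * sum (map f xs)  ≡⟨ *-distribˡ-+ k (f x) (sum (map f xs)) ⟨
      k * (f x + sum (map f xs))    ∎

    sum≤length* : ∀ {m} k (f : A → ℕ) {xs : List A} →
                  All (λ x → k * f x ≤ m) xs → k * sum (map f xs) ≤ length xs * m
    sum≤length* k f []           = ≤-reflexive (*-zeroʳ k)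
    sum≤length* k f {x ∷ xs} (upper ∷ uppers) = begin
      k * (f x + sum (map f xs))    ≡⟨ *-distribˡ-+ k (f x) (sum (map f xs)) ⟩
      k * f x + k * sum (map f xs)  ≤⟨ +-mono-≤ upper (sum≤length* k f uppers) ⟩
      _ + length xs * _             ∎

    pairSum≤C2* : ∀ {m} k (w : A → A → ℕ) {xs : List A} →
                  AllPairs (λ x y → k * w x y ≤ m) xs → k * pairSum w xs ≤ (length xs C 2) * m
    pairSum≤C2* k w []                = ≤-reflexive (*-zeroʳ k)
    pairSum≤C2* {m} k w {x ∷ xs} (uppers ∷ pairwise) = begin
      k * (R + P)               ≡⟨ *-distribˡ-+ k R P ⟩
      k * R + k * P             ≤⟨ +-mono-≤ (sum≤length* k (w x) uppers) (pairSum≤C2* k w pairwise) ⟩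
      l * m + (l C 2) * m        ≡⟨ *-distribʳ-+ m l (l C 2) ⟨
      (l + l C 2) * m           ≡⟨ cong (λ c → (c + l C 2) * m) (nC1≡n l) ⟨
      (l C 1 + l C 2) * m       ≡⟨ cong (_* m) (nCk+nC[k+1]≡[n+1]C[k+1] l 1) ⟩
      (suc l C 2) * m           ∎
      where
      l = length xs
      R = sum (map (w x) xs)
      P = pairSum w xs

  module _ {A : Set} {n : ℕ} where

    ∣p∩⋃∣≤sum : (p : Subset n) (f : A → Subset n) (xs : List A) →
                ∣ p ∩ ⋃ (map f xs) ∣ ≤ sum (map (λ x → ∣ p ∩ f x ∣) xs)
    ∣p∩⋃∣≤sum p f []       = ≤-reflexive (trans (cong ∣_∣ (∩-zeroʳ p)) (∣⊥∣≡0 n))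
    ∣p∩⋃∣≤sum p f (x ∷ xs) = begin
      ∣ p ∩ (f x ∪ ⋃ (map f xs)) ∣         ≡⟨ cong ∣_∣ (∩-distribˡ-∪ p (f x) (⋃ (map f xs))) ⟩
      ∣ p ∩ f x ∪ p ∩ ⋃ (map f xs) ∣       ≤⟨ ∣p∪q∣≤∣p∣+∣q∣ (p ∩ f x) (p ∩ ⋃ (map f xs)) ⟩
      ∣ p ∩ f x ∣ + ∣ p ∩ ⋃ (map f xs) ∣   ≤⟨ +-monoʳ-≤ ∣ p ∩ f x ∣ (∣p∩⋃∣≤sum p f xs) ⟩
      ∣ p ∩ f x ∣ + sum (map (λ y → ∣ p ∩ f y ∣) xs) ∎

    sum∣∣≤∣⋃∣+pairSum : (f : A → Subset n) (xs : List A) →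
      sum (map (λ x → ∣ f x ∣) xs) ≤ ∣ ⋃ (map f xs) ∣ + pairSum (λ x y → ∣ f x ∩ f y ∣) xs
    sum∣∣≤∣⋃∣+pairSum f []       = z≤n
    sum∣∣≤∣⋃∣+pairSum f (x ∷ xs) = begin
      ∣ f x ∣ + sum (map (λ y → ∣ f y ∣) xs)  ≤⟨ +-monoʳ-≤ ∣ f x ∣ (sum∣∣≤∣⋃∣+pairSum f xs) ⟩
      ∣ f x ∣ + (∣ U ∣ + P)                  ≡⟨ +-assoc ∣ f x ∣ ∣ U ∣ P ⟨
      ∣ f x ∣ + ∣ U ∣ + P                    ≡⟨ cong (_+ P) (∣p∪q∣+∣p∩q∣≡∣p∣+∣q∣ (f x) U) ⟨
      ∣ f x ∪ U ∣ + ∣ f x ∩ U ∣ + P          ≡⟨ +-assoc ∣ f x ∪ U ∣ ∣ f x ∩ U ∣ P ⟩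
      ∣ f x ∪ U ∣ + (∣ f x ∩ U ∣ + P)        ≤⟨ +-monoʳ-≤ ∣ f x ∪ U ∣ (+-monoˡ-≤ P (∣p∩⋃∣≤sum (f x) f xs)) ⟩
      ∣ f x ∪ U ∣ + (sum (map (λ y → ∣ f x ∩ f y ∣) xs) + P) ∎
      where
      U = ⋃ (map f xs)
      P = pairSum (λ x y → ∣ f x ∩ f y ∣) xs

  toSubset : ∀ {n} → List (Fin n) → Subset n
  toSubset xs = ⋃ (map ⁅_⁆ xs)

  ∈-toSubset : ∀ {n} {x : Fin n} {xs} → x List.∈ xs → x ∈ toSubset xs
  ∈-toSubset {x = x} (here refl) = x∈p∪q⁺ (inj₁ (x∈⁅x⁆ x))
  ∈-toSubset (there x∈xs)        = x∈p∪q⁺ (inj₂ (∈-toSubset x∈xs))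

  ∣toSubset∣≤length : ∀ {n} (xs : List (Fin n)) → ∣ toSubset xs ∣ ≤ length xs
  ∣toSubset∣≤length {n} []  = ≤-reflexive (∣⊥∣≡0 n)
  ∣toSubset∣≤length (x ∷ xs) = begin
    ∣ ⁅ x ⁆ ∪ toSubset xs ∣      ≤⟨ ∣p∪q∣≤∣p∣+∣q∣ ⁅ x ⁆ (toSubset xs) ⟩
    ∣ ⁅ x ⁆ ∣ + ∣ toSubset xs ∣  ≡⟨ cong (_+ ∣ toSubset xs ∣) (∣⁅x⁆∣≡1 x) ⟩
    suc ∣ toSubset xs ∣          ≤⟨ s≤s (∣toSubset∣≤length xs) ⟩
    suc (length xs)              ∎

module Greedy {A : Set} {R : A → A → Set} (R? : Decidable R) where
  open import Data.List using (List; []; _∷_)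
  open import Data.List.Relation.Unary.All using (all?)
  open import Data.List.Relation.Unary.All.Properties using (¬All⇒Any¬)
  open import Data.List.Relation.Unary.AllPairs using (AllPairs; []; _∷_)
  open import Data.List.Relation.Unary.Any using (here; there)
  open import Data.List.Membership.Propositional using (_∈_; find)
  open import Data.Product using (∃; _×_; _,_)
  open import Data.Sum using (_⊎_; inj₁; inj₂)
  open import Relation.Nullary using (¬_; yes; no)
  open import Relation.Binary.PropositionalEquality using (refl)

  extend : List A → List A → List A
  extend chosen []       = chosen
  extend chosen (x ∷ xs) with all? (R? x) chosen
  ... | yes _ = extend (x ∷ chosen) xs
  ... | no _  = extend chosen xs

  extend-pairwise : ∀ {chosen} xs → AllPairs R chosen → AllPairs R (extend chosen xs)
  extend-pairwise {chosen} []       pairwise = pairwise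
  extend-pairwise {chosen} (x ∷ xs) pairwise with all? (R? x) chosen
  ... | yes related = extend-pairwise xs (related ∷ pairwise)
  ... | no _        = extend-pairwise xs pairwise

  extend-⊇ : ∀ {chosen y} xs → y ∈ chosen → y ∈ extend chosen xs
  extend-⊇ {chosen} []       y∈ = y∈
  extend-⊇ {chosen} (x ∷ xs) y∈ with all? (R? x) chosen
  ... | yes _ = extend-⊇ xs (there y∈)
  ... | no _  = extend-⊇ xs y∈

  extend-maximal : ∀ {chosen y} xs → y ∈ xs →
    y ∈ extend chosen xs ⊎ ∃ λ s → s ∈ extend chosen xs × ¬ R y s
  extend-maximal {chosen} (x ∷ xs) (there y∈) with all? (R? x) chosen
  ... | yes _ = extend-maximal xs y∈
  ... | no _  = extend-maximal xs y∈
  extend-maximal {chosen} (x ∷ xs) (here refl) with all? (R? x) chosen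
  ... | yes _        = inj₁ (extend-⊇ xs (here refl))
  ... | no unrelated =
    let s , s∈ , ¬Rxs = find (¬All⇒Any¬ (R? x) chosen unrelated)
    in  inj₂ (s , extend-⊇ xs s∈ , ¬Rxs)

module Arithmetic where
  open import Data.Nat
  open import Data.Nat.Properties
  open import Data.Nat.Combinatorics using (_C_; nC1≡n; nCk+nC[k+1]≡[n+1]C[k+1])
  open import Data.Nat.Tactic.RingSolver using (solve-∀)
  open import Relation.Binary.PropositionalEquality

  2*[1+m]C2≡[1+m]*m : ∀ m → 2 * (suc m C 2) ≡ suc m * m
  2*[1+m]C2≡[1+m]*m zero    = refl
  2*[1+m]C2≡[1+m]*m (suc m) = begin
    2 * (suc (suc m) C 2)               ≡⟨ cong (2 *_) (nCk+nC[k+1]≡[n+1]C[k+1] (suc m) 1) ⟨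
    2 * (suc m C 1 + suc m C 2)         ≡⟨ *-distribˡ-+ 2 (suc m C 1) (suc m C 2) ⟩
    2 * (suc m C 1) + 2 * (suc m C 2)   ≡⟨ cong₂ (λ a b → 2 * a + b) (nC1≡n (suc m)) (2*[1+m]C2≡[1+m]*m m) ⟩
    2 * suc m + suc m * m               ≡⟨ e₁ m ⟩
    suc (suc m) * suc m                 ∎
    where
    open ≡-Reasoning
    e₁ : ∀ m → 2 * suc m + suc m * m ≡ suc (suc m) * suc m
    e₁ = solve-∀

  p*m≤2q⇒p*[1+m]≤2q : ∀ {n p q m Y} .{{_ : NonZero n}} .{{_ : NonZero q}} →
    suc m * (p * n) ≤ q * (n + Y) → 4 * q * q * Y ≤ (suc m C 2) * (p * p * n) →
    p * m ≤ 2 * q → p * suc m ≤ 2 * q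
  p*m≤2q⇒p*[1+m]≤2q {n} {p} {q} {m} {Y} degrees overlaps pm≤2q =
    *-cancelˡ-≤ 6 (begin
      6 * x       ≤⟨ 6x≤8q ⟩
      8 * q       ≤⟨ *-monoˡ-≤ q (m≤m+n 8 4) ⟩
      12 * q      ≡⟨ *-assoc 6 2 q ⟩
      6 * (2 * q) ∎)
    where
    x = p * suc m
    c = suc m C 2
    r = n * (q * (8 * q))
    open ≤-Reasoning
    -- x = p(m+1) stands for tδq; cancelling n leaves 6qx ≤ 8q², i.e. tδ ≤ 4/3.
    chain : n * (q * (6 * x)) + n * (q * (2 * x)) ≤ r + n * (q * (2 * x))
    chain = begin
      n * (q * (6 * x)) + n * (q * (2 * x)) ≡⟨ e₁ n p q m ⟩
      8 * q * (suc m * (p * n))             ≤⟨ *-monoʳ-≤ (8 * q) degrees ⟩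
      8 * q * (q * (n + Y))                 ≡⟨ e₂ n q Y ⟩
      r + 2 * (4 * q * q * Y)               ≤⟨ +-monoʳ-≤ r (*-monoʳ-≤ 2 overlaps) ⟩
      r + 2 * (c * (p * p * n))             ≡⟨ cong (r +_) (e₃ c (p * p * n)) ⟩
      r + 2 * c * (p * p * n)               ≡⟨ cong (λ d → r + d * (p * p * n)) (2*[1+m]C2≡[1+m]*m m) ⟩
      r + suc m * m * (p * p * n)           ≡⟨ cong (r +_) (e₄ n p m) ⟩
      r + n * (x * (p * m))                 ≤⟨ +-monoʳ-≤ r (*-monoʳ-≤ n (*-monoʳ-≤ x pm≤2q)) ⟩
      r + n * (x * (2 * q))                 ≡⟨ cong (r +_) (e₅ n x q) ⟩
      r + n * (q * (2 * x))                 ∎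
      where
      e₁ : ∀ n p q m → n * (q * (6 * (p * suc m))) + n * (q * (2 * (p * suc m))) ≡ 8 * q * (suc m * (p * n))
      e₁ = solve-∀
      e₂ : ∀ n q Y → 8 * q * (q * (n + Y)) ≡ n * (q * (8 * q)) + 2 * (4 * q * q * Y)
      e₂ = solve-∀
      e₃ : ∀ c d → 2 * (c * d) ≡ 2 * c * d
      e₃ = solve-∀
      e₄ : ∀ n p m → suc m * m * (p * p * n) ≡ n * (p * suc m * (p * m))
      e₄ = solve-∀
      e₅ : ∀ n x q → n * (x * (2 * q)) ≡ n * (q * (2 * x))
      e₅ = solve-∀
    6x≤8q : 6 * x ≤ 8 * q
    6x≤8q = *-cancelˡ-≤ q (*-cancelˡ-≤ n (+-cancelʳ-≤ _ _ _ chain))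

module SparseDominatingSet {n : ℕ} (G : Graph n) (p q : ℕ) .{{_ : Data.Nat.NonZero q}} where
  open import Data.Nat
  open import Data.Nat.Properties
  open import Data.Fin using (Fin)
  open import Data.Fin.Properties using (nonZeroIndex)
  open import Data.Fin.Subset using (Subset; _∈_; _∉_; _∩_; ∣_∣; ⋃)
  open import Data.Fin.Subset.Properties using (∣p∣≤n)
  open import Data.List using (List; []; _∷_; length; map; allFin)
  open import Data.List.Membership.Propositional.Properties using (∈-allFin)
  open import Data.List.Relation.Unary.AllPairs as AllPairs using (AllPairs; []; _∷_)
  open import Data.Product using (Σ; ∃; _×_; _,_)
  open import Data.Sum using (inj₁; inj₂)
  open import Relation.Nullary using (contradiction)
  open Graph G
  open Counting
  open Arithmetic

  -- |N(v) ∩ N(s)| < δ²n/4 for δ = p / q.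
  Far : Fin n → Fin n → Set
  Far v s = 4 * q * q * ∣ N v ∩ N s ∣ < p * p * n

  open Greedy {R = Far} (λ v s → _ <? _)

  module _ (minDegree : ∀ v → p * n ≤ q * ∣ N v ∣) where

    degreeSum : (vs : List (Fin n)) →
      length vs * (p * n) ≤ q * (n + pairSum (λ u v → ∣ N u ∩ N v ∣) vs)
    degreeSum vs = ≤-trans (length*≤sum q (λ v → ∣ N v ∣) minDegree vs)
      (*-monoʳ-≤ q (≤-trans (sum∣∣≤∣⋃∣+pairSum N vs)
                            (+-monoˡ-≤ _ (∣p∣≤n (⋃ (map N vs))))))

    pairwiseFar⇒p*length≤2q : ∀ {vs} → AllPairs Far vs → p * length vs ≤ 2 * q
    pairwiseFar⇒p*length≤2q []                         = ≤-trans (≤-reflexive (*-zeroʳ p)) z≤n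
    pairwiseFar⇒p*length≤2q {v ∷ vs} (farFromRest ∷ far) =
      p*m≤2q⇒p*[1+m]≤2q {n} {p} {q} {{nonZeroIndex v}}
        (degreeSum (v ∷ vs))
        (pairSum≤C2* (4 * q * q) (λ u w → ∣ N u ∩ N w ∣) (AllPairs.map <⇒≤ (farFromRest ∷ far)))
        (pairwiseFar⇒p*length≤2q far)

    sparseDominatingSet : Σ (Subset n) λ S → p * ∣ S ∣ ≤ 2 * q ×
      (∀ v → v ∉ S → ∃ λ s → s ∈ S × p * p * n ≤ 4 * q * q * ∣ N v ∩ N s ∣)
    sparseDominatingSet = toSubset chosen , small , dominating
      where
      chosen : List (Fin n)
      chosen = extend [] (allFin n)

      small : p * ∣ toSubset chosen ∣ ≤ 2 * q
      small = ≤-trans (*-monoʳ-≤ p (∣toSubset∣≤length chosen))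
                      (pairwiseFar⇒p*length≤2q (extend-pairwise (allFin n) []))

      dominating : ∀ v → v ∉ toSubset chosen →
        ∃ λ s → s ∈ toSubset chosen × p * p * n ≤ 4 * q * q * ∣ N v ∩ N s ∣
      dominating v v∉S with extend-maximal (allFin n) (∈-allFin v)
      ... | inj₁ v∈chosen        = contradiction (∈-toSubset v∈chosen) v∉S
      ... | inj₂ (s , s∈chosen , notFar) = s , ∈-toSubset s∈chosen , ≮⇒≥ notFar


module Fractions where
  open import Data.Nat as ℕ using (ℕ; suc)
  open import Data.Integer as ℤ using (+_)
  import Data.Integer.Properties as ℤ
  open import Data.Rational using (ℚ; _/_; _*_; _≤_; _÷_; 1/_; toℚᵘ; NonZero)
  open import Data.Rational.Properties using (toℚᵘ-homo-*; toℚᵘ-fromℚᵘ; toℚᵘ-mono-≤; toℚᵘ-cancel-≤)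
  import Data.Rational.Unnormalised as U
  import Data.Rational.Unnormalised.Properties as U
  open import Data.Nat.Tactic.RingSolver using (solve-∀)
  open import Relation.Binary.PropositionalEquality using (_≡_; cong; sym; subst₂)

  -- x ≅ a /1+ u : x = a / (1 + u), following the denominator convention of mkℚᵘ.
  infix 4 _≅_/1+_
  record _≅_/1+_ (x : ℚ) (a u : ℕ) : Set where
    constructor fraction
    field toℚᵘ-≃ : toℚᵘ x U.≃ U.mkℚᵘ (+ a) u
  open _≅_/1+_

  ≅-ℕ : ∀ n → (+ n) / 1 ≅ n /1+ 0
  ≅-ℕ n = fraction (toℚᵘ-fromℚᵘ (U.mkℚᵘ (+ n) 0))

  -- (1 + u)(1 + w) = 1 + (w + u(1 + w))
  ≅-* : ∀ {x y a u c w} → x ≅ a /1+ u → y ≅ c /1+ w → x * y ≅ a ℕ.* c /1+ (w ℕ.+ u ℕ.* suc w)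
  ≅-* {x} {y} {a} {u} {c} {w} x≅ y≅ = fraction (U.≃-trans (toℚᵘ-homo-* x y)
    (U.≃-trans (U.*-cong (toℚᵘ-≃ x≅) (toℚᵘ-≃ y≅))
               (U.*≡* (cong (ℤ._* (+ suc (w ℕ.+ u ℕ.* suc w))) (sym (ℤ.pos-* a c))))))

  ≤⇒cross-≤ : ∀ {x y a u c w} → x ≅ a /1+ u → y ≅ c /1+ w → x ≤ y → a ℕ.* suc w ℕ.≤ c ℕ.* suc u
  ≤⇒cross-≤ {a = a} {u} {c} {w} x≅ y≅ x≤y with U.≤-respʳ-≃ (toℚᵘ-≃ y≅) (U.≤-respˡ-≃ (toℚᵘ-≃ x≅) (toℚᵘ-mono-≤ x≤y))
  ... | U.*≤* cross = ℤ.drop‿+≤+ (subst₂ ℤ._≤_ (sym (ℤ.pos-* a (suc w))) (sym (ℤ.pos-* c (suc u))) cross)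

  cross-≤⇒≤ : ∀ {x y a u c w} → x ≅ a /1+ u → y ≅ c /1+ w → a ℕ.* suc w ℕ.≤ c ℕ.* suc u → x ≤ y
  cross-≤⇒≤ {a = a} {u} {c} {w} x≅ y≅ cross = toℚᵘ-cancel-≤
    (U.≤-respʳ-≃ (U.≃-sym (toℚᵘ-≃ y≅)) (U.≤-respˡ-≃ (U.≃-sym (toℚᵘ-≃ x≅))
      (U.*≤* (subst₂ ℤ._≤_ (ℤ.pos-* a (suc w)) (ℤ.pos-* c (suc u)) (ℤ.+≤+ cross)))))

  module _ {δ : ℚ} {a b : ℕ} (δ≅ : δ ≅ suc a /1+ b) where

    δn≤d⇒pn≤qd : ∀ {n d} → δ * ((+ n) / 1) ≤ (+ d) / 1 → suc a ℕ.* n ℕ.≤ suc b ℕ.* d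
    δn≤d⇒pn≤qd {n} {d} δn≤d = subst₂ ℕ._≤_ (e₁ a n) (e₂ b d) (≤⇒cross-≤ (≅-* δ≅ (≅-ℕ n)) (≅-ℕ d) δn≤d)
      where
      e₁ : ∀ a n → suc a ℕ.* n ℕ.* 1 ≡ suc a ℕ.* n
      e₁ = solve-∀
      e₂ : ∀ b d → d ℕ.* suc (0 ℕ.+ b ℕ.* 1) ≡ suc b ℕ.* d
      e₂ = solve-∀

    ps≤2q⇒s≤2/δ : ∀ {s} .{{_ : NonZero δ}} → 1/ δ ≅ suc b /1+ a →
                  suc a ℕ.* s ℕ.≤ 2 ℕ.* suc b → (+ s) / 1 ≤ ((+ 2) / 1) ÷ δ
    ps≤2q⇒s≤2/δ {s} 1/δ≅ ps≤2q = cross-≤⇒≤ (≅-ℕ s) (≅-* (≅-ℕ 2) 1/δ≅) (subst₂ ℕ._≤_ (e₁ a s) (e₂ b) ps≤2q)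
      where
      e₁ : ∀ a s → suc a ℕ.* s ≡ s ℕ.* suc (a ℕ.+ 0 ℕ.* suc a)
      e₁ = solve-∀
      e₂ : ∀ b → 2 ℕ.* suc b ≡ 2 ℕ.* suc b ℕ.* 1
      e₂ = solve-∀

    p²n≤4q²c⇒δ²n/4≤c : ∀ {n c} → suc a ℕ.* suc a ℕ.* n ℕ.≤ 4 ℕ.* suc b ℕ.* suc b ℕ.* c →
                       (δ * δ * ((+ n) / 1)) ÷ ((+ 4) / 1) ≤ (+ c) / 1
    p²n≤4q²c⇒δ²n/4≤c {n} {c} p²n≤4q²c = cross-≤⇒≤ (≅-* (≅-* (≅-* δ≅ δ≅) (≅-ℕ n)) (fraction U.≃-refl)) (≅-ℕ c)
      (subst₂ ℕ._≤_ (e₁ a n) (e₂ b c) p²n≤4q²c)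
      where
      e₁ : ∀ a n → suc a ℕ.* suc a ℕ.* n ≡ suc a ℕ.* suc a ℕ.* n ℕ.* 1 ℕ.* 1
      e₁ = solve-∀
      e₂ : ∀ b c → 4 ℕ.* suc b ℕ.* suc b ℕ.* c ≡ c ℕ.* suc (3 ℕ.+ (0 ℕ.+ (b ℕ.+ b ℕ.* suc b) ℕ.* 1) ℕ.* 4)
      e₂ = solve-∀


open import Defs
open import Data.Nat using (ℕ)
open import Data.Fin using (Fin)
open import Data.Fin.Subset using (Subset; _∈_; _∉_; _∩_; ∣_∣)
open import Data.Product using (Σ; ∃; _×_)
open import Data.Rational using (ℚ; _<_; _≤_; _*_; _÷_; _/_; >-nonZero; 0ℚ; 1ℚ; ½)
open import Data.Integer using (+_)

open import Data.Nat using (suc)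
open import Data.Integer using (+<+; -[1+_]; +[1+_])
open import Data.Rational using (mkℚ; *<*)
open import Data.Rational.Unnormalised.Properties using (≃-refl)
open import Data.Product using (_,_)
open import Function using (_∘_)
open SparseDominatingSet using (sparseDominatingSet)
open Fractions

lemma5 : (δ : ℚ) → (δpos : 0ℚ < δ) → δ < ½ →
    (n : ℕ) → (G : Graph n) →
    (∀ v → δ * ((+ n) / 1) ≤ (+ ∣ Graph.N G v ∣) / 1) →
    Σ (Subset n) λ S →
    ((+ ∣ S ∣) / 1 ≤ _÷_ ((+ 2) / 1) δ {{>-nonZero δpos}})
    × (∀ v → v ∉ S → ∃ λ s → s ∈ S
    × (δ * δ * ((+ n) / 1)) ÷ ((+ 4) / 1) ≤ (+ ∣ Graph.N G v ∩ Graph.N G s ∣) / 1)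
lemma5 (mkℚ (+ 0) _ _)    (*<* (+<+ ())) _ _ _ _
lemma5 (mkℚ -[1+ _ ] _ _) (*<* ())       _ _ _ _
lemma5 δ@(mkℚ +[1+ a ] b _) δpos _ n G minDegree =
  let S , small , dominating = sparseDominatingSet G (suc a) (suc b) (δn≤d⇒pn≤qd δ≅ ∘ minDegree)
  in  S , ps≤2q⇒s≤2/δ δ≅ {{>-nonZero δpos}} (fraction ≃-refl) small ,
      λ v v∉S → let s , s∈S , close = dominating v v∉S in s , s∈S , p²n≤4q²c⇒δ²n/4≤c δ≅ close
  where
  δ≅ : δ ≅ suc a /1+ b
  δ≅ = fraction ≃-refl
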